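{- Let $n,k$ be integers with $1\le k\le (n+1)/2$, and let $s(n,k)$ denote the minimum size $|\mathcal{A}\cup\mathcal{B}|$ of a full squashed flat antichain $\mathcal{A}\cup\mathcal{B}$ in $\binom{[n]}k\cup\binom{[n]}{k-1}$. Then \[ s(n,k)=s(n,n-k+1)=\binom{n}{k-1}-\sum_{i=1}^{k-1}\frac{1}{i+1}\binom{2i}{i}. \]
   Context: $[n]=\{1,\dots,n\}$, $\binom{[n]}{i}$ is the family of $i$-subsets of $[n]$. Squashed (colexicographic) order: for distinct $F,G\subseteq[n]$, $F<_S G$ iff $\max\bigl((F\cup G)\setminus(F\cap G)\bigr)\in G$. For $\mathcal{G}\subseteq\binom{[n]}{i}$, the shadow is $\Delta\mathcal{G}=\{H\in\binom{[n]}{i-1}: H\subset G \text{ for some } G\in\mathcal{G}\}$. A full squashed flat antichain in $\binom{[n]}k\cup\binom{[n]}{k-1}$ is a family $\mathcal{A}\cup\mathcal{B}$ where, for some $0\le m\le\binom nk$, $\mathcal{A}$ is the set of the first $m$ elements of $\binom{[n]}{k}$ in squashed order and $\mathcal{B}=\binom{[n]}{k-1}\setminus\Delta\mathcal{A}$. -}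

module Defs where

open import Data.Bool using (Bool; true; false; not; _∧_; _∨_; _xor_; if_then_else_)
open import Data.Nat using (ℕ; zero; suc; _+_; _*_; _∸_; _≤_; _<ᵇ_; _≡ᵇ_)
open import Data.Nat.DivMod using (_/_)
open import Data.Nat.Combinatorics using (_C_)
open import Data.Fin using (Fin; zero; suc)
open import Data.Vec using (Vec; []; _∷_; lookup; zipWith)
open import Data.List using (List; []; _∷_; _++_; map; filter; length; foldr)
open import Data.Bool.ListAction using (any)
open import Data.Fin.Subset using (Subset; inside; outside)
open import Data.Maybe using (Maybe; just; nothing)
open import Data.Product using (Σ; _×_; _,_)
open import Relation.Binary.PropositionalEquality using (_≡_)
open import Relation.Nullary.Decidable using (does)
open import Data.Bool.Properties using (T?)
open import Data.Bool using (T)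

-- A subset F ⊆ [n] is a 'Subset n' (characteristic vector); the index
-- i : Fin n stands for the element i+1 of [n].

allSubsets : (n : ℕ) → List (Subset n)
allSubsets zero    = [] ∷ []
allSubsets (suc n) = map (outside ∷_) (allSubsets n) ++ map (inside ∷_) (allSubsets n)

card : ∀ {n} → Subset n → ℕ
card []            = 0
card (true  ∷ xs)  = suc (card xs)
card (false ∷ xs)  = card xs

level : (n i : ℕ) → List (Subset n)
level n i = filter (λ F → T? (card F ≡ᵇ i)) (allSubsets n)

symdiff : ∀ {n} → Subset n → Subset n → Subset n
symdiff = zipWith _xor_

maxElem : ∀ {n} → Subset n → Maybe (Fin n)
maxElem []       = nothing
maxElem (b ∷ bs) with maxElem bs
... | just j  = just (suc j)
... | nothing = if b then just zero else nothing

_<S_ : ∀ {n} → Subset n → Subset n → Bool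
F <S G with maxElem (symdiff F G)
... | just j  = lookup G j
... | nothing = false

countB : ∀ {a} {A : Set a} → (A → Bool) → List A → ℕ
countB p xs = length (filter (λ x → T? (p x)) xs)

-- the first m elements of ([n] choose k) in squashed order:
-- those F with fewer than m predecessors in ([n] choose k)
firstSquashed : (n k m : ℕ) → List (Subset n)
firstSquashed n k m =
  filter (λ F → T? (countB (λ G → G <S F) (level n k) <ᵇ m)) (level n k)

_⊆B_ : ∀ {n} → Subset n → Subset n → Bool
[]       ⊆B []       = true
(x ∷ xs) ⊆B (y ∷ ys) = (not x ∨ y) ∧ (xs ⊆B ys)

inShadow : ∀ {n} → Subset n → List (Subset n) → Bool
inShadow H 𝒢 = any (λ G → H ⊆B G) 𝒢

squashedA : (n k m : ℕ) → List (Subset n)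
squashedA = firstSquashed

squashedB : (n k m : ℕ) → List (Subset n)
squashedB n k m = filter (λ H → T? (not (inShadow H (squashedA n k m)))) (level n (k ∸ 1))

-- |𝒜 ∪ ℬ| (𝒜 and ℬ lie in different levels, and are duplicate-free,
-- so the union is the concatenation)
flatSize : (n k m : ℕ) → ℕ
flatSize n k m = length (squashedA n k m ++ squashedB n k m)

-- s(n,k) = v : v is the minimum of |𝒜 ∪ ℬ| over all full squashed flat
-- antichains in ([n] choose k) ∪ ([n] choose k-1), i.e. over 0 ≤ m ≤ (n choose k)
IsMinFlatSize : (n k v : ℕ) → Set
IsMinFlatSize n k v =
  Σ ℕ (λ m → m ≤ n C k × flatSize n k m ≡ v)
  × (∀ m → m ≤ n C k → v ≤ flatSize n k m)

-- Σ_{i=1}^{j} (1/(i+1)) binom(2i,i)   (the division is exact: Catalan numbers)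
catalanSum : ℕ → ℕ
catalanSum zero    = 0
catalanSum (suc j) = catalanSum j + ((2 * suc j) C (suc j)) / suc (suc j)

module Submission where

-- Let f(n,k,m) be the size of the full squashed flat antichain of [n] whose upper part
-- consists of the first m k-sets. Adding a new largest element n+1 splits the k-sets of
-- [n+1] into those avoiding n+1, which come first in squashed order, and those containing
-- it. If m ≤ C(n,k), all chosen sets avoid n+1, and the (k-1)-sets containing n+1 are
-- outside the shadow: f(n+1,k,m) = f(n,k,m) + C(n,k-2). Otherwise all k-sets avoiding
-- n+1 are chosen, their shadow is the whole level k-1 of [n], and the sets containing
-- n+1 behave like (k-1)-sets of [n]: f(n+1,k,m) = C(n,k) + f(n,k-1,m-C(n,k)). Hence
--   s(n+1,k) = min (s(n,k) + C(n,k-2)) (C(n,k) + s(n,k-1)),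
-- with s(n,1) = s(n,n) = 1, and the closed form follows by induction: below the middle
-- level the first term is the smaller one by unimodality of the binomial coefficients,
-- above it the second, and at the middle both agree, the identity
-- C(2j,j) - C(2j,j+1) = C(2j,j)/(j+1) supplying the new Catalan number.

open import Defs
open import Data.Nat using (ℕ; suc; _+_; _*_; _∸_; _≤_)
open import Data.Nat.Combinatorics using (_C_)
open import Data.Product using (_×_)

import Algebra.Properties.CommutativeSemigroup
open import Data.Bool using (Bool; true; false; not; _∧_; _∨_; _xor_; if_then_else_)
open import Data.Bool.ListAction using (any)
open import Data.Bool.Properties using (T?; T-≡; ∧-zeroʳ; ∧-identityʳ; ∧-assoc; ∨-identityʳ)
open import Data.Fin using (zero; suc; fromℕ; inject₁)
open import Data.Fin.Subset using (Subset)
open import Data.List using (List; []; _∷_; _++_; map; filter; length)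
open import Data.List.Membership.Propositional using (_∈_; lose)
open import Data.List.Membership.Propositional.Properties using (∈-map⁺; ∈-++⁺ˡ; ∈-++⁺ʳ)
open import Data.List.Properties using (filter-++; length-++; filter-some)
open import Data.List.Relation.Unary.Any using (here)
open import Data.Maybe using (just; nothing; maybe′)
import Data.Maybe as Maybe
open import Data.Nat using (zero; _<_; _<ᵇ_; _≡ᵇ_; z≤n; s≤s; s≤s⁻¹; _⊓_)
open import Data.Nat.Combinatorics
  using (nCk+nC[k+1]≡[n+1]C[k+1]; nCk≡nC[n∸k]; k>n⇒nCk≡0; nC1≡n; nCn≡1)
open import Data.Nat.DivMod using (_/_; m*n/n≡m)
open import Data.Nat.Properties
open import Data.Nat.Tactic.RingSolver using (solve-∀)
open import Data.Product using (Σ-syntax; _,_; proj₁; proj₂)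
open import Data.Vec using ([]; _∷_; _∷ʳ_; lookup; initLast)
open import Function using (_∘_)
open import Function.Bundles using (module Equivalence)
open import Relation.Binary.Definitions using (tri<; tri≈; tri>)
open import Relation.Binary.PropositionalEquality
open import Relation.Nullary using (yes; no; contradiction)

open Equivalence using (to; from)
open Algebra.Properties.CommutativeSemigroup +-commutativeSemigroup using (xy∙z≈xz∙y; interchange)

-- Binomial coefficients

pascal : ∀ n k → suc n C suc k ≡ n C k + n C suc k
pascal n k = sym (nCk+nC[k+1]≡[n+1]C[k+1] n k)

nCk≤[1+n]Ck : ∀ n k → n C k ≤ suc n C k
nCk≤[1+n]Ck n zero    = ≤-refl
nCk≤[1+n]Ck n (suc k) = subst (n C suc k ≤_) (sym (pascal n k)) (m≤n+m (n C suc k) (n C k))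

C-symmetric : ∀ x y → (x + y) C x ≡ (x + y) C y
C-symmetric x y = trans (nCk≡nC[n∸k] (m≤m+n x y)) (cong ((x + y) C_) (m+n∸m≡n x y))

C-absorption : ∀ n k → suc k * (suc n C suc k) ≡ suc n * (n C k)
C-absorption zero    zero    = refl
C-absorption zero    (suc k) = begin
  suc (suc k) * (1 C suc (suc k)) ≡⟨ cong (suc (suc k) *_) (k>n⇒nCk≡0 {1} {suc (suc k)} (s≤s (s≤s z≤n))) ⟩
  suc (suc k) * 0                 ≡⟨ *-zeroʳ (suc (suc k)) ⟩
  0                               ≡⟨ k>n⇒nCk≡0 {0} {suc k} (s≤s z≤n) ⟨
  0 C suc k                       ≡⟨ *-identityˡ (0 C suc k) ⟨
  1 * (0 C suc k)                 ∎
  where open ≡-Reasoning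
C-absorption (suc n) zero    = begin
  1 * (suc (suc n) C 1) ≡⟨ *-identityˡ (suc (suc n) C 1) ⟩
  suc (suc n) C 1       ≡⟨ nC1≡n (suc (suc n)) ⟩
  suc (suc n)           ≡⟨ *-identityʳ (suc (suc n)) ⟨
  suc (suc n) * 1       ∎
  where open ≡-Reasoning
C-absorption (suc n) (suc k) = begin
  suc (suc k) * (suc (suc n) C suc (suc k))   ≡⟨ cong (suc (suc k) *_) (pascal (suc n) (suc k)) ⟩
  suc (suc k) * (P + Q)                       ≡⟨ distribute k P Q ⟩
  P + (suc k * P + suc (suc k) * Q)
    ≡⟨ cong₂ (λ x y → P + (x + y)) (C-absorption n k) (C-absorption n (suc k)) ⟩
  P + (suc n * (n C k) + suc n * (n C suc k)) ≡⟨ cong (P +_) (*-distribˡ-+ (suc n) (n C k) (n C suc k)) ⟨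
  P + suc n * (n C k + n C suc k)             ≡⟨ cong (λ z → P + suc n * z) (pascal n k) ⟨
  suc (suc n) * P                             ∎
  where
  open ≡-Reasoning
  P Q : ℕ
  P = suc n C suc k
  Q = suc n C suc (suc k)
  distribute : ∀ k P Q → suc (suc k) * (P + Q) ≡ P + (suc k * P + suc (suc k) * Q)
  distribute = solve-∀

-- (k+1) C(n,k+1) = (n-k) C(n,k), with the subtraction moved to the other side.
C-ratio : ∀ n k → suc k * (n C suc k) + suc k * (n C k) ≡ suc n * (n C k)
C-ratio n k = begin
  suc k * (n C suc k) + suc k * (n C k) ≡⟨ *-distribˡ-+ (suc k) (n C suc k) (n C k) ⟨
  suc k * (n C suc k + n C k)           ≡⟨ cong (suc k *_) (+-comm (n C suc k) (n C k)) ⟩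
  suc k * (n C k + n C suc k)           ≡⟨ cong (suc k *_) (pascal n k) ⟨
  suc k * (suc n C suc k)               ≡⟨ C-absorption n k ⟩
  suc n * (n C k)                       ∎
  where open ≡-Reasoning

C-unimodal : ∀ n j → 2 * suc j ≤ suc n → n C j ≤ n C suc j
C-unimodal n j 2[j+1]≤n+1 = *-cancelˡ-≤ (suc j) (+-cancelʳ-≤ (suc j * a) (suc j * a) (suc j * b) (begin
  suc j * a + suc j * a ≡⟨ double j a ⟩
  (2 * suc j) * a       ≤⟨ *-monoˡ-≤ a 2[j+1]≤n+1 ⟩
  suc n * a             ≡⟨ C-ratio n j ⟨
  suc j * b + suc j * a ∎))
  where
  open ≤-Reasoning
  a b : ℕ
  a = n C j
  b = n C suc j
  double : ∀ j a → suc j * a + suc j * a ≡ (2 * suc j) * a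
  double = solve-∀

C-unimodal-lowerHalf : ∀ x y → suc x ≤ y → let n = suc (suc (x + y)) in n C suc x ≤ n C suc (suc x)
C-unimodal-lowerHalf x y x<y = C-unimodal (suc (suc (x + y))) (suc x) (begin
  2 * suc (suc x)           ≡⟨ double x ⟩
  suc (suc (suc x)) + suc x ≤⟨ +-monoʳ-≤ (suc (suc (suc x))) x<y ⟩
  suc (suc (suc (x + y)))   ∎)
  where
  open ≤-Reasoning
  double : ∀ x → 2 * suc (suc x) ≡ suc (suc (suc x)) + suc x
  double = solve-∀

catalan+C≡C : ∀ j → ((2 * j) C j) / suc j + (2 * j) C suc j ≡ (2 * j) C j
catalan+C≡C j = trans (cong (_+ d) c/[j+1]≡c∸d) (m∸n+n≡m d≤c)
  where
  c d : ℕ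
  c = (2 * j) C j
  d = (2 * j) C suc j
  [j+1]d≡jc : suc j * d ≡ j * c
  [j+1]d≡jc = +-cancelʳ-≡ (suc j * c) (suc j * d) (j * c) (trans (C-ratio (2 * j) j) (split j c))
    where
    split : ∀ j c → suc (2 * j) * c ≡ j * c + suc j * c
    split = solve-∀
  d≤c : d ≤ c
  d≤c = *-cancelˡ-≤ (suc j) (subst (_≤ suc j * c) (sym [j+1]d≡jc) (*-monoˡ-≤ c (n≤1+n j)))
  [c∸d][j+1]≡c : (c ∸ d) * suc j ≡ c
  [c∸d][j+1]≡c = begin
    (c ∸ d) * suc j           ≡⟨ *-distribʳ-∸ (suc j) c d ⟩
    c * suc j ∸ d * suc j     ≡⟨ cong₂ _∸_ (*-comm c (suc j)) (*-comm d (suc j)) ⟩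
    suc j * c ∸ suc j * d     ≡⟨ cong (suc j * c ∸_) [j+1]d≡jc ⟩
    (c + j * c) ∸ j * c       ≡⟨ m+n∸n≡m c (j * c) ⟩
    c                         ∎
    where open ≡-Reasoning
  c/[j+1]≡c∸d : c / suc j ≡ c ∸ d
  c/[j+1]≡c∸d = trans (cong (_/ suc j) (sym [c∸d][j+1]≡c)) (m*n/n≡m (c ∸ d) (suc j))

catalanSum≤catalanSum-suc : ∀ j → catalanSum j ≤ catalanSum (suc j)
catalanSum≤catalanSum-suc j = m≤m+n (catalanSum j) _

-- Counting with Boolean predicates

module _ {a} {A : Set a} where

  countB-++ : (p : A → Bool) (xs ys : List A) → countB p (xs ++ ys) ≡ countB p xs + countB p ys
  countB-++ p xs ys = trans (cong length (filter-++ (T? ∘ p) xs ys)) (length-++ (filter (T? ∘ p) xs))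

  countB-map : ∀ {b} {B : Set b} (p : B → Bool) (f : A → B) (xs : List A) →
               countB p (map f xs) ≡ countB (p ∘ f) xs
  countB-map p f []       = refl
  countB-map p f (x ∷ xs) with p (f x)
  ... | true  = cong suc (countB-map p f xs)
  ... | false = countB-map p f xs

  countB-cong : {p q : A → Bool} → (∀ x → p x ≡ q x) → (xs : List A) → countB p xs ≡ countB q xs
  countB-cong p≗q []       = refl
  countB-cong {p} {q} p≗q (x ∷ xs) with p x | q x | p≗q x
  ... | true  | .true  | refl = cong suc (countB-cong p≗q xs)
  ... | false | .false | refl = countB-cong p≗q xs

  countB-none : {p : A → Bool} → (∀ x → p x ≡ false) → (xs : List A) → countB p xs ≡ 0
  countB-none {p} none []       = refl
  countB-none {p} none (x ∷ xs) with p x | none x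
  ... | false | refl = countB-none none xs

  countB-some : {p : A → Bool} {x : A} {xs : List A} → x ∈ xs → p x ≡ true → 0 < countB p xs
  countB-some {p} x∈xs px = filter-some (T? ∘ p) (lose x∈xs (from T-≡ px))

  countB-filter : (p q : A → Bool) (xs : List A) →
                  countB p (filter (T? ∘ q) xs) ≡ countB (λ x → q x ∧ p x) xs
  countB-filter p q []       = refl
  countB-filter p q (x ∷ xs) with q x
  ... | false = countB-filter p q xs
  ... | true with p x
  ...   | true  = cong suc (countB-filter p q xs)
  ...   | false = countB-filter p q xs

  any≡0<countB : (p : A → Bool) (xs : List A) → any p xs ≡ (0 <ᵇ countB p xs)
  any≡0<countB p []       = refl
  any≡0<countB p (x ∷ xs) with p x
  ... | true  = refl
  ... | false = any≡0<countB p xs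

<ᵇ-zero : ∀ r → (r <ᵇ 0) ≡ false
<ᵇ-zero zero    = refl
<ᵇ-zero (suc r) = refl

+<ᵇ≡<ᵇ∸ : ∀ c r m → (c + r <ᵇ m) ≡ (r <ᵇ m ∸ c)
+<ᵇ≡<ᵇ∸ zero    r m       = refl
+<ᵇ≡<ᵇ∸ (suc c) r zero    = sym (<ᵇ-zero r)
+<ᵇ≡<ᵇ∸ (suc c) r (suc m) = +<ᵇ≡<ᵇ∸ c r m

0<ᵇ+ : ∀ x y → (0 <ᵇ x + y) ≡ ((0 <ᵇ x) ∨ (0 <ᵇ y))
0<ᵇ+ zero    y = refl
0<ᵇ+ (suc x) y = refl

-- Subsets of [n + 1] split by the largest element

countSubsets : (n : ℕ) → (Subset n → Bool) → ℕ
countSubsets n p = countB p (allSubsets n)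

∈-allSubsets : ∀ {n} (F : Subset n) → F ∈ allSubsets n
∈-allSubsets []          = here refl
∈-allSubsets (false ∷ F) = ∈-++⁺ˡ (∈-map⁺ (false ∷_) (∈-allSubsets F))
∈-allSubsets (true  ∷ F) = ∈-++⁺ʳ _ (∈-map⁺ (true ∷_) (∈-allSubsets F))

countSubsets-∷ : ∀ n (p : Subset (suc n) → Bool) →
  countSubsets (suc n) p ≡ countSubsets n (p ∘ (false ∷_)) + countSubsets n (p ∘ (true ∷_))
countSubsets-∷ n p = begin
  countB p (map (false ∷_) (allSubsets n) ++ map (true ∷_) (allSubsets n))
    ≡⟨ countB-++ p (map (false ∷_) (allSubsets n)) (map (true ∷_) (allSubsets n)) ⟩
  countB p (map (false ∷_) (allSubsets n)) + countB p (map (true ∷_) (allSubsets n))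
    ≡⟨ cong₂ _+_ (countB-map p (false ∷_) (allSubsets n)) (countB-map p (true ∷_) (allSubsets n)) ⟩
  countSubsets n (p ∘ (false ∷_)) + countSubsets n (p ∘ (true ∷_)) ∎
  where open ≡-Reasoning

countSubsets-∷ʳ : ∀ n (p : Subset (suc n) → Bool) →
  countSubsets (suc n) p ≡ countSubsets n (p ∘ (_∷ʳ false)) + countSubsets n (p ∘ (_∷ʳ true))
countSubsets-∷ʳ zero    p =
  trans (countSubsets-∷ zero p) (cong₂ _+_ (countB-cong empty (allSubsets 0)) (countB-cong empty (allSubsets 0)))
  where
  empty : ∀ {b} (F : Subset 0) → p (b ∷ F) ≡ p (F ∷ʳ b)
  empty [] = refl
countSubsets-∷ʳ (suc n) p = begin
  countSubsets (suc (suc n)) p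
    ≡⟨ countSubsets-∷ (suc n) p ⟩
  countSubsets (suc n) (p ∘ (false ∷_)) + countSubsets (suc n) (p ∘ (true ∷_))
    ≡⟨ cong₂ _+_ (countSubsets-∷ʳ n (p ∘ (false ∷_))) (countSubsets-∷ʳ n (p ∘ (true ∷_))) ⟩
  (#ff + #ft) + (#tf + #tt)
    ≡⟨ interchange #ff #ft #tf #tt ⟩
  (#ff + #tf) + (#ft + #tt)
    ≡⟨ cong₂ _+_ (countSubsets-∷ n (p ∘ (_∷ʳ false))) (countSubsets-∷ n (p ∘ (_∷ʳ true))) ⟨
  countSubsets (suc n) (p ∘ (_∷ʳ false)) + countSubsets (suc n) (p ∘ (_∷ʳ true)) ∎
  where
  open ≡-Reasoning
  #ff #ft #tf #tt : ℕ
  #ff = countSubsets n (λ F → p (false ∷ (F ∷ʳ false)))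
  #ft = countSubsets n (λ F → p (false ∷ (F ∷ʳ true)))
  #tf = countSubsets n (λ F → p (true ∷ (F ∷ʳ false)))
  #tt = countSubsets n (λ F → p (true ∷ (F ∷ʳ true)))

countSubsets-card : ∀ n k → countSubsets n (λ F → card F ≡ᵇ k) ≡ n C k
countSubsets-card zero    zero    = refl
countSubsets-card zero    (suc k) = refl
countSubsets-card (suc n) zero    =
  trans (countSubsets-∷ n _) (cong₂ _+_ (countSubsets-card n zero) (countB-none (λ _ → refl) (allSubsets n)))
countSubsets-card (suc n) (suc k) = begin
  countSubsets (suc n) (λ F → card F ≡ᵇ suc k)
    ≡⟨ countSubsets-∷ n _ ⟩
  countSubsets n (λ F → card F ≡ᵇ suc k) + countSubsets n (λ F → card F ≡ᵇ k)
    ≡⟨ cong₂ _+_ (countSubsets-card n (suc k)) (countSubsets-card n k) ⟩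
  n C suc k + n C k
    ≡⟨ +-comm (n C suc k) (n C k) ⟩
  n C k + n C suc k
    ≡⟨ pascal n k ⟨
  suc n C suc k ∎
  where open ≡-Reasoning

card-∷ʳ-false : ∀ {n} (F : Subset n) → card (F ∷ʳ false) ≡ card F
card-∷ʳ-false []          = refl
card-∷ʳ-false (true  ∷ F) = cong suc (card-∷ʳ-false F)
card-∷ʳ-false (false ∷ F) = card-∷ʳ-false F

card-∷ʳ-true : ∀ {n} (F : Subset n) → card (F ∷ʳ true) ≡ suc (card F)
card-∷ʳ-true []          = refl
card-∷ʳ-true (true  ∷ F) = cong suc (card-∷ʳ-true F)
card-∷ʳ-true (false ∷ F) = card-∷ʳ-true F

⊆B-refl : ∀ {n} (F : Subset n) → F ⊆B F ≡ true
⊆B-refl []          = refl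
⊆B-refl (true  ∷ F) = ⊆B-refl F
⊆B-refl (false ∷ F) = ⊆B-refl F

⊆B-∷ʳ-false : ∀ {n} (H G : Subset n) b → (H ∷ʳ false) ⊆B (G ∷ʳ b) ≡ H ⊆B G
⊆B-∷ʳ-false []      []      b = refl
⊆B-∷ʳ-false (x ∷ H) (y ∷ G) b = cong ((not x ∨ y) ∧_) (⊆B-∷ʳ-false H G b)

⊆B-∷ʳ-true : ∀ {n} (H G : Subset n) → (H ∷ʳ true) ⊆B (G ∷ʳ true) ≡ H ⊆B G
⊆B-∷ʳ-true []      []      = refl
⊆B-∷ʳ-true (x ∷ H) (y ∷ G) = cong ((not x ∨ y) ∧_) (⊆B-∷ʳ-true H G)

⊆B-∷ʳ-true-false : ∀ {n} (H G : Subset n) → (H ∷ʳ true) ⊆B (G ∷ʳ false) ≡ false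
⊆B-∷ʳ-true-false []      []      = refl
⊆B-∷ʳ-true-false (x ∷ H) (y ∷ G) = trans (cong ((not x ∨ y) ∧_) (⊆B-∷ʳ-true-false H G)) (∧-zeroʳ _)

superset-of-size-suc : ∀ {n} (H : Subset n) → card H < n →
                       Σ[ G ∈ Subset n ] card G ≡ suc (card H) × H ⊆B G ≡ true
superset-of-size-suc (false ∷ H) _ = true ∷ H , refl , ⊆B-refl H
superset-of-size-suc (true  ∷ H) (s≤s card<n) with superset-of-size-suc H card<n
... | G , cardG , H⊆G = true ∷ G , cong suc cardG , H⊆G

<S-viaMax : ∀ {n} (G F : Subset n) → G <S F ≡ maybe′ (lookup F) false (maxElem (symdiff G F))
<S-viaMax G F with maxElem (symdiff G F)
... | just j  = refl
... | nothing = refl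

symdiff-∷ʳ : ∀ {n} (G F : Subset n) c b → symdiff (G ∷ʳ c) (F ∷ʳ b) ≡ symdiff G F ∷ʳ (c xor b)
symdiff-∷ʳ []      []      c b = refl
symdiff-∷ʳ (x ∷ G) (y ∷ F) c b = cong ((x xor y) ∷_) (symdiff-∷ʳ G F c b)

maxElem-∷ʳ-true : ∀ {n} (F : Subset n) → maxElem (F ∷ʳ true) ≡ just (fromℕ n)
maxElem-∷ʳ-true []      = refl
maxElem-∷ʳ-true (x ∷ F) rewrite maxElem-∷ʳ-true F = refl

maxElem-∷ʳ-false : ∀ {n} (F : Subset n) → maxElem (F ∷ʳ false) ≡ Maybe.map inject₁ (maxElem F)
maxElem-∷ʳ-false []      = refl
maxElem-∷ʳ-false (x ∷ F) rewrite maxElem-∷ʳ-false F with maxElem F | x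
... | just j  | _     = refl
... | nothing | true  = refl
... | nothing | false = refl

lookup-∷ʳ-last : ∀ {n} (F : Subset n) b → lookup (F ∷ʳ b) (fromℕ n) ≡ b
lookup-∷ʳ-last []      b = refl
lookup-∷ʳ-last (x ∷ F) b = lookup-∷ʳ-last F b

lookup-∷ʳ-inject₁ : ∀ {n} (F : Subset n) b j → lookup (F ∷ʳ b) (inject₁ j) ≡ lookup F j
lookup-∷ʳ-inject₁ (x ∷ F) b zero    = refl
lookup-∷ʳ-inject₁ (x ∷ F) b (suc j) = lookup-∷ʳ-inject₁ F b j

<S-∷ʳ : ∀ {n} (G F : Subset n) c b → (G ∷ʳ c) <S (F ∷ʳ b) ≡ (if c xor b then b else G <S F)
<S-∷ʳ {n} G F c b = begin
  (G ∷ʳ c) <S (F ∷ʳ b)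
    ≡⟨ <S-viaMax (G ∷ʳ c) (F ∷ʳ b) ⟩
  maybe′ (lookup (F ∷ʳ b)) false (maxElem (symdiff (G ∷ʳ c) (F ∷ʳ b)))
    ≡⟨ cong (maybe′ (lookup (F ∷ʳ b)) false ∘ maxElem) (symdiff-∷ʳ G F c b) ⟩
  maybe′ (lookup (F ∷ʳ b)) false (maxElem (symdiff G F ∷ʳ (c xor b)))
    ≡⟨ lastDecides (c xor b) ⟩
  (if c xor b then b else maybe′ (lookup F) false (maxElem (symdiff G F)))
    ≡⟨ cong (if c xor b then b else_) (<S-viaMax G F) ⟨
  (if c xor b then b else G <S F) ∎
  where
  open ≡-Reasoning
  lastDecides : ∀ d → maybe′ (lookup (F ∷ʳ b)) false (maxElem (symdiff G F ∷ʳ d))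
                    ≡ (if d then b else maybe′ (lookup F) false (maxElem (symdiff G F)))
  lastDecides true  rewrite maxElem-∷ʳ-true (symdiff G F) = lookup-∷ʳ-last F b
  lastDecides false rewrite maxElem-∷ʳ-false (symdiff G F) with maxElem (symdiff G F)
  ... | just j  = lookup-∷ʳ-inject₁ F b j
  ... | nothing = refl

-- Initial segments of the squashed order and their shadows

rank : (n k : ℕ) → Subset n → ℕ
rank n k F = countSubsets n (λ G → (card G ≡ᵇ k) ∧ (G <S F))

rank-∷ʳ-false : ∀ n k (F : Subset n) → rank (suc n) k (F ∷ʳ false) ≡ rank n k F
rank-∷ʳ-false n k F = begin
  rank (suc n) k (F ∷ʳ false)
    ≡⟨ countSubsets-∷ʳ n _ ⟩
  countSubsets n (λ G → (card (G ∷ʳ false) ≡ᵇ k) ∧ ((G ∷ʳ false) <S (F ∷ʳ false)))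
  + countSubsets n (λ G → (card (G ∷ʳ true) ≡ᵇ k) ∧ ((G ∷ʳ true) <S (F ∷ʳ false)))
    ≡⟨ cong₂ _+_ sameTop (countB-none noneTop (allSubsets n)) ⟩
  rank n k F + 0
    ≡⟨ +-identityʳ (rank n k F) ⟩
  rank n k F ∎
  where
  open ≡-Reasoning
  sameTop : countSubsets n (λ G → (card (G ∷ʳ false) ≡ᵇ k) ∧ ((G ∷ʳ false) <S (F ∷ʳ false))) ≡ rank n k F
  sameTop = countB-cong (λ G → cong₂ (λ c b → (c ≡ᵇ k) ∧ b) (card-∷ʳ-false G) (<S-∷ʳ G F false false))
                        (allSubsets n)
  noneTop : ∀ G → ((card (G ∷ʳ true) ≡ᵇ k) ∧ ((G ∷ʳ true) <S (F ∷ʳ false))) ≡ false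
  noneTop G = trans (cong ((card (G ∷ʳ true) ≡ᵇ k) ∧_) (<S-∷ʳ G F true false)) (∧-zeroʳ _)

rank-∷ʳ-true : ∀ n k (F : Subset n) → rank (suc n) (suc k) (F ∷ʳ true) ≡ n C suc k + rank n k F
rank-∷ʳ-true n k F = trans (countSubsets-∷ʳ n _) (cong₂ _+_ smaller sameTop)
  where
  smaller : countSubsets n (λ G → (card (G ∷ʳ false) ≡ᵇ suc k) ∧ ((G ∷ʳ false) <S (F ∷ʳ true)))
            ≡ n C suc k
  smaller = trans (countB-cong (λ G → trans (cong₂ (λ c b → (c ≡ᵇ suc k) ∧ b) (card-∷ʳ-false G)
                                                    (<S-∷ʳ G F false true))
                                            (∧-identityʳ _))
                               (allSubsets n))
                  (countSubsets-card n (suc k))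
  sameTop : countSubsets n (λ G → (card (G ∷ʳ true) ≡ᵇ suc k) ∧ ((G ∷ʳ true) <S (F ∷ʳ true)))
            ≡ rank n k F
  sameTop = countB-cong (λ G → cong₂ (λ c b → (c ≡ᵇ suc k) ∧ b) (card-∷ʳ-true G) (<S-∷ʳ G F true true))
                        (allSubsets n)

rank<C : ∀ n k (F : Subset n) → card F ≡ k → rank n k F < n C k
rank<C zero    .0 [] refl = s≤s z≤n
rank<C (suc n) k  F  cardF with initLast F
... | F , false , refl = begin-strict
  rank (suc n) k (F ∷ʳ false) ≡⟨ rank-∷ʳ-false n k F ⟩
  rank n k F                  <⟨ rank<C n k F (trans (sym (card-∷ʳ-false F)) cardF) ⟩
  n C k                       ≤⟨ nCk≤[1+n]Ck n k ⟩
  suc n C k                   ∎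
  where open ≤-Reasoning
... | F , true , refl with trans (sym (card-∷ʳ-true F)) cardF
...   | refl = begin-strict
  rank (suc n) (suc j) (F ∷ʳ true) ≡⟨ rank-∷ʳ-true n j F ⟩
  n C suc j + rank n j F           <⟨ +-monoʳ-< (n C suc j) (rank<C n j F refl) ⟩
  n C suc j + n C j                ≡⟨ +-comm (n C suc j) (n C j) ⟩
  n C j + n C suc j                ≡⟨ pascal n j ⟨
  suc n C suc j                    ∎
  where
  open ≤-Reasoning
  j : ℕ
  j = card F

-- The paper's 𝒜 consists of the F with initial n k m F, its shadow Δ𝒜 of the covered H,
-- and flat n k m is |𝒜 ∪ ℬ|.
initial : (n k m : ℕ) → Subset n → Bool
initial n k m F = (card F ≡ᵇ k) ∧ (rank n k F <ᵇ m)

covering : (n k m : ℕ) → Subset n → ℕ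
covering n k m H = countSubsets n (λ G → initial n k m G ∧ (H ⊆B G))

covered : (n k m : ℕ) → Subset n → Bool
covered n k m H = 0 <ᵇ covering n k m H

initialCount : (n k m : ℕ) → ℕ
initialCount n k m = countSubsets n (initial n k m)

-- The (k-1)-sets are those H with |H| + 1 = k, so that there are none when k = 0.
uncoveredCount : (n k m : ℕ) → ℕ
uncoveredCount n k m = countSubsets n (λ H → (suc (card H) ≡ᵇ k) ∧ not (covered n k m H))

flat : (n k m : ℕ) → ℕ
flat n k m = initialCount n k m + uncoveredCount n k m

rank≡countB-level : ∀ n k (F : Subset n) → countB (_<S F) (level n k) ≡ rank n k F
rank≡countB-level n k F = countB-filter (_<S F) (λ G → card G ≡ᵇ k) (allSubsets n)

firstSquashed-test≡initial : ∀ n k m (F : Subset n) →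
                             (card F ≡ᵇ k) ∧ (countB (_<S F) (level n k) <ᵇ m) ≡ initial n k m F
firstSquashed-test≡initial n k m F = cong (λ r → (card F ≡ᵇ k) ∧ (r <ᵇ m)) (rank≡countB-level n k F)

length-squashedA : ∀ n k m → length (squashedA n k m) ≡ initialCount n k m
length-squashedA n k m = trans (countB-filter _ (λ F → card F ≡ᵇ k) (allSubsets n))
                               (countB-cong (firstSquashed-test≡initial n k m) (allSubsets n))

inShadow≡covered : ∀ n k m (H : Subset n) → inShadow H (squashedA n k m) ≡ covered n k m H
inShadow≡covered n k m H = begin
  any (H ⊆B_) (squashedA n k m)
    ≡⟨ any≡0<countB (H ⊆B_) (squashedA n k m) ⟩
  0 <ᵇ countB (H ⊆B_) (squashedA n k m)
    ≡⟨ cong (0 <ᵇ_) (countB-filter (H ⊆B_) _ (level n k)) ⟩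
  0 <ᵇ countB (λ G → (countB (_<S G) (level n k) <ᵇ m) ∧ (H ⊆B G)) (level n k)
    ≡⟨ cong (0 <ᵇ_) (countB-filter _ (λ G → card G ≡ᵇ k) (allSubsets n)) ⟩
  0 <ᵇ countSubsets n (λ G → (card G ≡ᵇ k) ∧ ((countB (_<S G) (level n k) <ᵇ m) ∧ (H ⊆B G)))
    ≡⟨ cong (0 <ᵇ_) (countB-cong reassociate (allSubsets n)) ⟩
  covered n k m H ∎
  where
  open ≡-Reasoning
  reassociate : ∀ G → (card G ≡ᵇ k) ∧ ((countB (_<S G) (level n k) <ᵇ m) ∧ (H ⊆B G))
                      ≡ initial n k m G ∧ (H ⊆B G)
  reassociate G = trans (sym (∧-assoc (card G ≡ᵇ k) _ (H ⊆B G)))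
                        (cong (_∧ (H ⊆B G)) (firstSquashed-test≡initial n k m G))

length-squashedB : ∀ n k m → length (squashedB n (suc k) m) ≡ uncoveredCount n (suc k) m
length-squashedB n k m =
  trans (countB-filter _ (λ H → card H ≡ᵇ k) (allSubsets n))
        (countB-cong (λ H → cong (λ b → (card H ≡ᵇ k) ∧ not b) (inShadow≡covered n (suc k) m H)) (allSubsets n))

flatSize≡flat : ∀ n k m → flatSize n (suc k) m ≡ flat n (suc k) m
flatSize≡flat n k m =
  trans (length-++ (squashedA n (suc k) m)) (cong₂ _+_ (length-squashedA n (suc k) m) (length-squashedB n k m))

initial-zero : ∀ n k (F : Subset n) → initial n k 0 F ≡ false
initial-zero n k F = trans (cong ((card F ≡ᵇ k) ∧_) (<ᵇ-zero (rank n k F))) (∧-zeroʳ _)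

covered-zero : ∀ n k (H : Subset n) → covered n k 0 H ≡ false
covered-zero n k H = cong (0 <ᵇ_) (countB-none (λ G → cong (_∧ (H ⊆B G)) (initial-zero n k G)) (allSubsets n))

initialCount-zero : ∀ n k → initialCount n k 0 ≡ 0
initialCount-zero n k = countB-none (initial-zero n k) (allSubsets n)

initial-all : ∀ n k m (F : Subset n) → n C k ≤ m → initial n k m F ≡ (card F ≡ᵇ k)
initial-all n k m F C≤m with card F ≡ᵇ k in cardF
... | false = refl
... | true  = to T-≡ (<⇒<ᵇ (≤-trans (rank<C n k F (≡ᵇ⇒≡ (card F) k (from T-≡ cardF))) C≤m))

initialCount-all : ∀ n k m → n C k ≤ m → initialCount n k m ≡ n C k
initialCount-all n k m C≤m =
  trans (countB-cong (λ F → initial-all n k m F C≤m) (allSubsets n)) (countSubsets-card n k)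

flat-zero : ∀ n k → flat n (suc k) 0 ≡ n C k
flat-zero n k = cong₂ _+_ (initialCount-zero n (suc k))
  (trans (countB-cong (λ H → trans (cong (λ b → (card H ≡ᵇ k) ∧ not b) (covered-zero n (suc k) H)) (∧-identityʳ _))
                      (allSubsets n))
         (countSubsets-card n k))

covered-if-⊆initial : ∀ n k m (H G : Subset n) → initial n k m G ≡ true → H ⊆B G ≡ true →
                      covered n k m H ≡ true
covered-if-⊆initial n k m H G G-initial H⊆G =
  to T-≡ (<⇒<ᵇ (countB-some (∈-allSubsets G) (cong₂ _∧_ G-initial H⊆G)))

covered-below-full-level : ∀ n k m (H : Subset n) → suc k ≤ n → n C suc k ≤ m → card H ≡ k →
                           covered n (suc k) m H ≡ true
covered-below-full-level n k m H k<n C≤m refl with superset-of-size-suc H k<n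
... | G , cardG , H⊆G = covered-if-⊆initial n (suc k) m H G
  (trans (initial-all n (suc k) m G C≤m) (to T-≡ (≡⇒≡ᵇ (card G) (suc k) cardG))) H⊆G

uncoveredCount-full-level : ∀ n k m → suc k ≤ n → n C suc k ≤ m → uncoveredCount n (suc k) m ≡ 0
uncoveredCount-full-level n k m k<n C≤m = countB-none uncovered (allSubsets n)
  where
  uncovered : ∀ H → ((card H ≡ᵇ k) ∧ not (covered n (suc k) m H)) ≡ false
  uncovered H with card H ≡ᵇ k in cardH
  ... | false = refl
  ... | true  = cong not (covered-below-full-level n k m H k<n C≤m (≡ᵇ⇒≡ (card H) k (from T-≡ cardH)))

module _ (n k m : ℕ) where

  private
    m′ : ℕ
    m′ = m ∸ n C suc k

  initial-∷ʳ-false : ∀ F → initial (suc n) (suc k) m (F ∷ʳ false) ≡ initial n (suc k) m F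
  initial-∷ʳ-false F = cong₂ (λ c r → (c ≡ᵇ suc k) ∧ (r <ᵇ m)) (card-∷ʳ-false F) (rank-∷ʳ-false n (suc k) F)

  initial-∷ʳ-true : ∀ F → initial (suc n) (suc k) m (F ∷ʳ true) ≡ initial n k m′ F
  initial-∷ʳ-true F = cong₂ (λ c b → (c ≡ᵇ suc k) ∧ b) (card-∷ʳ-true F)
    (trans (cong (_<ᵇ m) (rank-∷ʳ-true n k F)) (+<ᵇ≡<ᵇ∸ (n C suc k) (rank n k F) m))

  initialCount-∷ʳ : initialCount (suc n) (suc k) m ≡ initialCount n (suc k) m + initialCount n k m′
  initialCount-∷ʳ = trans (countSubsets-∷ʳ n _)
    (cong₂ _+_ (countB-cong initial-∷ʳ-false (allSubsets n)) (countB-cong initial-∷ʳ-true (allSubsets n)))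

  covering-∷ʳ-false : ∀ H →
    covering (suc n) (suc k) m (H ∷ʳ false) ≡ covering n (suc k) m H + covering n k m′ H
  covering-∷ʳ-false H = trans (countSubsets-∷ʳ n _) (cong₂ _+_
    (countB-cong (λ G → cong₂ _∧_ (initial-∷ʳ-false G) (⊆B-∷ʳ-false H G false)) (allSubsets n))
    (countB-cong (λ G → cong₂ _∧_ (initial-∷ʳ-true G) (⊆B-∷ʳ-false H G true)) (allSubsets n)))

  covering-∷ʳ-true : ∀ H → covering (suc n) (suc k) m (H ∷ʳ true) ≡ covering n k m′ H
  covering-∷ʳ-true H = trans (countSubsets-∷ʳ n _) (cong₂ _+_
    (countB-none (λ G → trans (cong (_ ∧_) (⊆B-∷ʳ-true-false H G)) (∧-zeroʳ _)) (allSubsets n))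
    (countB-cong (λ G → cong₂ _∧_ (initial-∷ʳ-true G) (⊆B-∷ʳ-true H G)) (allSubsets n)))

  covered-∷ʳ-false : ∀ H →
    covered (suc n) (suc k) m (H ∷ʳ false) ≡ (covered n (suc k) m H ∨ covered n k m′ H)
  covered-∷ʳ-false H =
    trans (cong (0 <ᵇ_) (covering-∷ʳ-false H)) (0<ᵇ+ (covering n (suc k) m H) (covering n k m′ H))

  covered-∷ʳ-true : ∀ H → covered (suc n) (suc k) m (H ∷ʳ true) ≡ covered n k m′ H
  covered-∷ʳ-true H = cong (0 <ᵇ_) (covering-∷ʳ-true H)

  uncoveredCount-∷ʳ : uncoveredCount (suc n) (suc k) m
    ≡ countSubsets n (λ H → (card H ≡ᵇ k) ∧ not (covered n (suc k) m H ∨ covered n k m′ H)) + uncoveredCount n k m′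
  uncoveredCount-∷ʳ = trans (countSubsets-∷ʳ n _) (cong₂ _+_
    (countB-cong (λ H → cong₂ (λ c b → (c ≡ᵇ k) ∧ not b) (card-∷ʳ-false H) (covered-∷ʳ-false H)) (allSubsets n))
    (countB-cong (λ H → cong₂ (λ c b → (c ≡ᵇ k) ∧ not b) (card-∷ʳ-true H) (covered-∷ʳ-true H)) (allSubsets n)))

  private
    -- the uncovered k-sets of [n + 1] avoiding n + 1
    uncoveredAvoiding : ℕ → ℕ
    uncoveredAvoiding z = countSubsets n (λ H → (card H ≡ᵇ k) ∧ not (covered n (suc k) m H ∨ covered n k z H))

    flat-∷ʳ : flat (suc n) (suc k) m
              ≡ (initialCount n (suc k) m + initialCount n k m′) + (uncoveredAvoiding m′ + uncoveredCount n k m′)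
    flat-∷ʳ = cong₂ _+_ initialCount-∷ʳ uncoveredCount-∷ʳ

  flat-∷ʳ-below : m ≤ n C suc k →
                  flat (suc n) (suc k) m ≡ flat n (suc k) m + countSubsets n (λ H → suc (card H) ≡ᵇ k)
  flat-∷ʳ-below m≤C = begin
    flat (suc n) (suc k) m
      ≡⟨ flat-∷ʳ ⟩
    (A + initialCount n k m′) + (uncoveredAvoiding m′ + uncoveredCount n k m′)
      ≡⟨ cong (λ z → (A + initialCount n k z) + (uncoveredAvoiding z + uncoveredCount n k z)) (m≤n⇒m∸n≡0 m≤C) ⟩
    (A + initialCount n k 0) + (uncoveredAvoiding 0 + uncoveredCount n k 0)
      ≡⟨ cong₂ (λ a u → (A + a) + u) (initialCount-zero n k) (cong₂ _+_ avoiding0 containing0) ⟩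
    (A + 0) + (uncoveredCount n (suc k) m + below)
      ≡⟨ cong (_+ (uncoveredCount n (suc k) m + below)) (+-identityʳ A) ⟩
    A + (uncoveredCount n (suc k) m + below)
      ≡⟨ +-assoc A (uncoveredCount n (suc k) m) below ⟨
    flat n (suc k) m + below ∎
    where
    open ≡-Reasoning
    A below : ℕ
    A     = initialCount n (suc k) m
    below = countSubsets n (λ H → suc (card H) ≡ᵇ k)
    avoiding0 : uncoveredAvoiding 0 ≡ uncoveredCount n (suc k) m
    avoiding0 = countB-cong (λ H → cong (λ b → (card H ≡ᵇ k) ∧ not b)
                              (trans (cong (covered n (suc k) m H ∨_) (covered-zero n k H)) (∨-identityʳ _)))
                            (allSubsets n)
    containing0 : uncoveredCount n k 0 ≡ below
    containing0 = countB-cong (λ H → trans (cong (λ b → (suc (card H) ≡ᵇ k) ∧ not b) (covered-zero n k H))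
                                           (∧-identityʳ _))
                              (allSubsets n)

  flat-∷ʳ-above : suc k ≤ n → n C suc k ≤ m → flat (suc n) (suc k) m ≡ n C suc k + flat n k m′
  flat-∷ʳ-above k<n C≤m = begin
    flat (suc n) (suc k) m
      ≡⟨ flat-∷ʳ ⟩
    (initialCount n (suc k) m + initialCount n k m′) + (uncoveredAvoiding m′ + uncoveredCount n k m′)
      ≡⟨ cong₂ (λ a u → (a + initialCount n k m′) + (u + uncoveredCount n k m′))
               (initialCount-all n (suc k) m C≤m) (countB-none allCovered (allSubsets n)) ⟩
    (n C suc k + initialCount n k m′) + uncoveredCount n k m′
      ≡⟨ +-assoc (n C suc k) (initialCount n k m′) (uncoveredCount n k m′) ⟩
    n C suc k + flat n k m′ ∎
    where
    open ≡-Reasoning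
    allCovered : ∀ H → ((card H ≡ᵇ k) ∧ not (covered n (suc k) m H ∨ covered n k m′ H)) ≡ false
    allCovered H with card H ≡ᵇ k in cardH
    ... | false = refl
    ... | true  = cong (λ b → not (b ∨ covered n k m′ H))
                       (covered-below-full-level n k m H k<n C≤m (≡ᵇ⇒≡ (card H) k (from T-≡ cardH)))

IsMinFlat : (n k v : ℕ) → Set
IsMinFlat n k v = (Σ[ m ∈ ℕ ] m ≤ n C k × flat n k m ≡ v) × (∀ m → m ≤ n C k → v ≤ flat n k m)

IsMinFlat⇒IsMinFlatSize : ∀ {n k v} → IsMinFlat n (suc k) v → IsMinFlatSize n (suc k) v
IsMinFlat⇒IsMinFlatSize {n} {k} {v} ((m , m≤C , flat≡v) , minimal) =
  (m , m≤C , trans (flatSize≡flat n k m) flat≡v) ,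
  λ m′ m′≤C → subst (v ≤_) (sym (flatSize≡flat n k m′)) (minimal m′ m′≤C)

module _ {N t vA vB : ℕ} (k≤N : suc (suc t) ≤ N)
         (minA : IsMinFlat N (suc (suc t)) vA) (minB : IsMinFlat N (suc t) vB) where

  private
    flat-∷ʳ-below′ : ∀ m → m ≤ N C suc (suc t) → flat (suc N) (suc (suc t)) m ≡ flat N (suc (suc t)) m + N C t
    flat-∷ʳ-below′ m m≤C =
      trans (flat-∷ʳ-below N (suc t) m m≤C) (cong (flat N (suc (suc t)) m +_) (countSubsets-card N t))

    pascal′ : suc N C suc (suc t) ≡ N C suc (suc t) + N C suc t
    pascal′ = trans (pascal N (suc t)) (+-comm (N C suc t) (N C suc (suc t)))

    lowerBound : ∀ {v} → v ≤ vA + N C t → v ≤ N C suc (suc t) + vB →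
                 ∀ m → m ≤ suc N C suc (suc t) → v ≤ flat (suc N) (suc (suc t)) m
    lowerBound {v} v≤left v≤right m m≤C with m ≤? N C suc (suc t)
    ... | yes m≤C₀ = begin
      v                              ≤⟨ v≤left ⟩
      vA + N C t                     ≤⟨ +-monoˡ-≤ (N C t) (proj₂ minA m m≤C₀) ⟩
      flat N (suc (suc t)) m + N C t ≡⟨ flat-∷ʳ-below′ m m≤C₀ ⟨
      flat (suc N) (suc (suc t)) m   ∎
      where open ≤-Reasoning
    ... | no m≰C₀ = begin
      v                                      ≤⟨ v≤right ⟩
      C₀ + vB                                ≤⟨ +-monoʳ-≤ C₀ (proj₂ minB (m ∸ C₀) m∸C₀≤C) ⟩
      C₀ + flat N (suc t) (m ∸ C₀)           ≡⟨ flat-∷ʳ-above N (suc t) m k≤N (≰⇒≥ m≰C₀) ⟨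
      flat (suc N) (suc (suc t)) m           ∎
      where
      open ≤-Reasoning
      C₀ : ℕ
      C₀ = N C suc (suc t)
      m∸C₀≤C : m ∸ C₀ ≤ N C suc t
      m∸C₀≤C = m≤n+o⇒m∸n≤o m C₀ (subst (m ≤_) pascal′ m≤C)

  isMinFlat-∷ʳ-below : vA + N C t ≤ N C suc (suc t) + vB → IsMinFlat (suc N) (suc (suc t)) (vA + N C t)
  isMinFlat-∷ʳ-below below≤above with proj₁ minA
  ... | mA , mA≤C , flat≡vA =
    (mA , ≤-trans mA≤C (nCk≤[1+n]Ck N (suc (suc t))) ,
          trans (flat-∷ʳ-below′ mA mA≤C) (cong (_+ N C t) flat≡vA)) ,
    lowerBound ≤-refl below≤above

  isMinFlat-∷ʳ-above : N C suc (suc t) + vB ≤ vA + N C t → IsMinFlat (suc N) (suc (suc t)) (N C suc (suc t) + vB)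
  isMinFlat-∷ʳ-above above≤below with proj₁ minB
  ... | mB , mB≤C , flat≡vB = (C₀ + mB , subst (C₀ + mB ≤_) (sym pascal′) (+-monoʳ-≤ C₀ mB≤C) , flat≡) ,
                              lowerBound above≤below ≤-refl
    where
    C₀ : ℕ
    C₀ = N C suc (suc t)
    flat≡ : flat (suc N) (suc (suc t)) (C₀ + mB) ≡ C₀ + vB
    flat≡ = trans (flat-∷ʳ-above N (suc t) (C₀ + mB) k≤N (m≤m+n C₀ mB))
                  (cong (C₀ +_) (trans (cong (flat N (suc t)) (m+n∸m≡n C₀ mB)) flat≡vB))

flat-wholeSet≡1 : ∀ a → flat (suc a) (suc a) 1 ≡ 1
flat-wholeSet≡1 a = cong₂ _+_ (trans (initialCount-all (suc a) (suc a) 1 C≤1) (nCn≡1 (suc a)))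
                         (uncoveredCount-full-level (suc a) a 1 ≤-refl C≤1)
  where
  C≤1 : suc a C suc a ≤ 1
  C≤1 = ≤-reflexive (nCn≡1 (suc a))

isMinFlat-k≡n : ∀ a → IsMinFlat (suc a) (suc a) 1
isMinFlat-k≡n a = (1 , ≤-reflexive (sym (nCn≡1 (suc a))) , flat-wholeSet≡1 a) , minimal
  where
  [1+a]Ca≡1+a : suc a C a ≡ suc a
  [1+a]Ca≡1+a = trans (nCk≡nC[n∸k] (n≤1+n a)) (trans (cong (suc a C_) (m+n∸n≡m 1 a)) (nC1≡n (suc a)))
  minimal : ∀ m → m ≤ suc a C suc a → 1 ≤ flat (suc a) (suc a) m
  minimal zero          _   = subst (1 ≤_) (sym (trans (flat-zero (suc a) a) [1+a]Ca≡1+a)) (s≤s z≤n)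
  minimal (suc zero)    _   = ≤-reflexive (sym (flat-wholeSet≡1 a))
  minimal (suc (suc m)) m≤1 = contradiction (subst (suc (suc m) ≤_) (nCn≡1 (suc a)) m≤1) λ { (s≤s ()) }

isMinFlat-k≡1 : ∀ b → IsMinFlat (suc b) 1 1
isMinFlat-k≡1 b = (1 , 1≤[1+n]C1 b , flat₁ b) , minimal (suc b)
  where
  1≤[1+n]C1 : ∀ n → 1 ≤ suc n C 1
  1≤[1+n]C1 n = subst (1 ≤_) (sym (nC1≡n (suc n))) (s≤s z≤n)
  flat₁-∷ʳ-below : ∀ n m → m ≤ n C 1 → flat (suc n) 1 m ≡ flat n 1 m
  flat₁-∷ʳ-below n m m≤C = begin
    flat (suc n) 1 m
      ≡⟨ flat-∷ʳ-below n 0 m m≤C ⟩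
    flat n 1 m + countSubsets n (λ H → suc (card H) ≡ᵇ 0)
      ≡⟨ cong (flat n 1 m +_) (countB-none (λ _ → refl) (allSubsets n)) ⟩
    flat n 1 m + 0
      ≡⟨ +-identityʳ (flat n 1 m) ⟩
    flat n 1 m ∎
    where open ≡-Reasoning
  flat₁ : ∀ b → flat (suc b) 1 1 ≡ 1
  flat₁ zero    = flat-wholeSet≡1 0
  flat₁ (suc b) = trans (flat₁-∷ʳ-below (suc b) 1 (1≤[1+n]C1 b)) (flat₁ b)
  minimal : ∀ n m → m ≤ n C 1 → 1 ≤ flat n 1 m
  minimal zero    zero    _  = ≤-reflexive (sym (flat-zero 0 0))
  minimal zero    (suc m) ()
  minimal (suc n) m       m≤C with m ≤? n C 1
  ... | yes m≤n = subst (1 ≤_) (sym (flat₁-∷ʳ-below n m m≤n)) (minimal n m m≤n)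
  ... | no  m≰n = begin
    1                        ≤⟨ s≤s z≤n ⟩
    suc n                    ≡⟨ nC1≡n (suc n) ⟨
    suc n C 1                ≡⟨ initialCount-all (suc n) 1 m C≤m ⟨
    initialCount (suc n) 1 m ≤⟨ m≤m+n (initialCount (suc n) 1 m) (uncoveredCount (suc n) 1 m) ⟩
    flat (suc n) 1 m         ∎
    where
    open ≤-Reasoning
    C≤m : suc n C 1 ≤ m
    C≤m = subst (_≤ m) (sym (nC1≡n (suc n))) (subst (_< m) (nC1≡n n) (≰⇒> m≰n))

ClosedForm : (n j v : ℕ) → Set
ClosedForm n j v = v + catalanSum j ≡ n C j

module _ (a b : ℕ) {vA vB : ℕ} where

  private
    N : ℕ
    N = suc (suc (a + b))

  closedForm-lowerHalf : suc a ≤ b → ClosedForm N (suc a) vA → ClosedForm N a vB →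
    vA + N C a ≤ N C suc (suc a) + vB × ClosedForm (suc N) (suc a) (vA + N C a)
  closedForm-lowerHalf a<b cfA cfB = +-cancelʳ-≤ (catalanSum a) (vA + N C a) (N C suc (suc a) + vB) ineq , eq
    where
    open ≤-Reasoning
    ineq : (vA + N C a) + catalanSum a ≤ (N C suc (suc a) + vB) + catalanSum a
    ineq = begin
      (vA + N C a) + catalanSum a         ≡⟨ xy∙z≈xz∙y vA (N C a) (catalanSum a) ⟩
      (vA + catalanSum a) + N C a         ≤⟨ +-monoˡ-≤ (N C a) (+-monoʳ-≤ vA (catalanSum≤catalanSum-suc a)) ⟩
      (vA + catalanSum (suc a)) + N C a   ≡⟨ cong (_+ N C a) cfA ⟩
      N C suc a + N C a                   ≤⟨ +-monoˡ-≤ (N C a) (C-unimodal-lowerHalf a b a<b) ⟩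
      N C suc (suc a) + N C a             ≡⟨ cong (N C suc (suc a) +_) cfB ⟨
      N C suc (suc a) + (vB + catalanSum a) ≡⟨ +-assoc (N C suc (suc a)) vB (catalanSum a) ⟨
      (N C suc (suc a) + vB) + catalanSum a ∎
    eq : ClosedForm (suc N) (suc a) (vA + N C a)
    eq = begin-equality
      (vA + N C a) + catalanSum (suc a)   ≡⟨ xy∙z≈xz∙y vA (N C a) (catalanSum (suc a)) ⟩
      (vA + catalanSum (suc a)) + N C a   ≡⟨ cong (_+ N C a) cfA ⟩
      N C suc a + N C a                   ≡⟨ +-comm (N C suc a) (N C a) ⟩
      N C a + N C suc a                   ≡⟨ pascal N a ⟨
      suc N C suc a                       ∎

module _ (a : ℕ) {vA vB : ℕ} where

  private
    N : ℕ
    N = suc (suc (a + a))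

  closedForm-middle : ClosedForm N a vA → ClosedForm N a vB →
    N C suc (suc a) + vB ≤ vA + N C a × ClosedForm (suc N) (suc a) (N C suc (suc a) + vB)
  closedForm-middle cfA cfB = ≤-reflexive ineq , eq
    where
    open ≡-Reasoning
    vB≡vA : vB ≡ vA
    vB≡vA = +-cancelʳ-≡ (catalanSum a) vB vA (trans cfB (sym cfA))
    ineq : N C suc (suc a) + vB ≡ vA + N C a
    ineq = trans (cong₂ _+_ (C-symmetric (suc (suc a)) a) vB≡vA) (+-comm (N C a) vA)
    cat : ℕ
    cat = ((2 * suc a) C suc a) / suc (suc a)
    2[1+a]≡N : 2 * suc a ≡ N
    2[1+a]≡N = double a
      where
      double : ∀ a → 2 * suc a ≡ suc (suc (a + a))
      double = solve-∀
    catalan : cat + N C suc (suc a) ≡ N C suc a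
    catalan = subst (λ M → cat + M C suc (suc a) ≡ M C suc a) 2[1+a]≡N (catalan+C≡C (suc a))
    rearrange : ∀ x y z w → (x + y) + (z + w) ≡ (x + w) + (y + z)
    rearrange = solve-∀
    eq : ClosedForm (suc N) (suc a) (N C suc (suc a) + vB)
    eq = begin
      (N C suc (suc a) + vB) + (catalanSum a + cat)  ≡⟨ rearrange (N C suc (suc a)) vB (catalanSum a) cat ⟩
      (N C suc (suc a) + cat) + (vB + catalanSum a)  ≡⟨ cong₂ _+_ (trans (+-comm (N C suc (suc a)) cat) catalan) cfB ⟩
      N C suc a + N C a                              ≡⟨ +-comm (N C suc a) (N C a) ⟩
      N C a + N C suc a                              ≡⟨ pascal N a ⟨
      suc N C suc a                                  ∎

module _ (a b : ℕ) {vA vB : ℕ} where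

  private
    N : ℕ
    N = suc (suc (a + b))

  closedForm-upperHalf : suc b ≤ a → ClosedForm N b vA → ClosedForm N (suc b) vB →
    N C suc (suc a) + vB ≤ vA + N C a × ClosedForm (suc N) (suc b) (N C suc (suc a) + vB)
  closedForm-upperHalf b<a cfA cfB = +-cancelʳ-≤ (catalanSum b) (N C suc (suc a) + vB) (vA + N C a) ineq , eq
    where
    open ≤-Reasoning
    NC[2+a]≡NCb : N C suc (suc a) ≡ N C b
    NC[2+a]≡NCb = C-symmetric (suc (suc a)) b
    NCa≡NC[2+b] : N C a ≡ N C suc (suc b)
    NCa≡NC[2+b] = subst (λ M → M C a ≡ M C suc (suc b)) (shift a b) (C-symmetric a (suc (suc b)))
      where
      shift : ∀ a b → a + suc (suc b) ≡ suc (suc (a + b))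
      shift = solve-∀
    unimodal : N C suc b ≤ N C suc (suc b)
    unimodal = subst (λ n → suc (suc n) C suc b ≤ suc (suc n) C suc (suc b)) (+-comm b a) (C-unimodal-lowerHalf b a b<a)
    ineq : (N C suc (suc a) + vB) + catalanSum b ≤ (vA + N C a) + catalanSum b
    ineq = begin
      (N C suc (suc a) + vB) + catalanSum b  ≡⟨ cong (λ c → (c + vB) + catalanSum b) NC[2+a]≡NCb ⟩
      (N C b + vB) + catalanSum b            ≡⟨ +-assoc (N C b) vB (catalanSum b) ⟩
      N C b + (vB + catalanSum b)            ≤⟨ +-monoʳ-≤ (N C b) (+-monoʳ-≤ vB (catalanSum≤catalanSum-suc b)) ⟩
      N C b + (vB + catalanSum (suc b))      ≡⟨ cong (N C b +_) cfB ⟩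
      N C b + N C suc b                      ≤⟨ +-monoʳ-≤ (N C b) unimodal ⟩
      N C b + N C suc (suc b)                ≡⟨ cong₂ _+_ cfA NCa≡NC[2+b] ⟨
      (vA + catalanSum b) + N C a            ≡⟨ xy∙z≈xz∙y vA (N C a) (catalanSum b) ⟨
      (vA + N C a) + catalanSum b            ∎
    eq : ClosedForm (suc N) (suc b) (N C suc (suc a) + vB)
    eq = begin-equality
      (N C suc (suc a) + vB) + catalanSum (suc b) ≡⟨ +-assoc (N C suc (suc a)) vB (catalanSum (suc b)) ⟩
      N C suc (suc a) + (vB + catalanSum (suc b)) ≡⟨ cong₂ _+_ NC[2+a]≡NCb cfB ⟩
      N C b + N C suc b                           ≡⟨ pascal N b ⟨
      suc N C suc b                               ∎

-- Indexed by a = k - 1 and b = n - k, in which the closed form depends only on min a b.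
FlatMinimum : (n k j : ℕ) → Set
FlatMinimum n k j = Σ[ v ∈ ℕ ] IsMinFlat n k v × ClosedForm n j v

reindex : ∀ n v {j j′} → j ≡ j′ → ClosedForm n j v → ClosedForm n j′ v
reindex n v refl cf = cf

flatMinimum-step : ∀ a b → let N = suc (suc (a + b)) in
  FlatMinimum N (suc (suc a)) (suc a ⊓ b) → FlatMinimum N (suc a) (a ⊓ suc b) →
  FlatMinimum (suc N) (suc (suc a)) (suc (a ⊓ b))
flatMinimum-step a b (vA , minA , cfA) (vB , minB , cfB) with <-cmp a b
... | tri< a<b _ _ =
  vA + N C a , isMinFlat-∷ʳ-below k≤N minA minB (proj₁ step) , reindex (suc N) (vA + N C a) a≡a⊓b (proj₂ step)
  where
  N : ℕ
  N = suc (suc (a + b))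
  k≤N : suc (suc a) ≤ N
  k≤N = s≤s (s≤s (m≤m+n a b))
  a≡a⊓b : suc a ≡ suc (a ⊓ b)
  a≡a⊓b = cong suc (sym (m≤n⇒m⊓n≡m (<⇒≤ a<b)))
  step : vA + N C a ≤ N C suc (suc a) + vB × ClosedForm (suc N) (suc a) (vA + N C a)
  step = closedForm-lowerHalf a b a<b (reindex N vA (m≤n⇒m⊓n≡m a<b) cfA)
                                      (reindex N vB (m≤n⇒m⊓n≡m (m≤n⇒m≤1+n (<⇒≤ a<b))) cfB)
... | tri≈ _ refl _ =
  N C suc (suc a) + vB , isMinFlat-∷ʳ-above k≤N minA minB (proj₁ step) ,
  reindex (suc N) (N C suc (suc a) + vB) a≡a⊓a (proj₂ step)
  where
  N : ℕ
  N = suc (suc (a + a))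
  k≤N : suc (suc a) ≤ N
  k≤N = s≤s (s≤s (m≤m+n a a))
  a≡a⊓a : suc a ≡ suc (a ⊓ a)
  a≡a⊓a = cong suc (sym (⊓-idem a))
  step : N C suc (suc a) + vB ≤ vA + N C a × ClosedForm (suc N) (suc a) (N C suc (suc a) + vB)
  step = closedForm-middle a (reindex N vA (m≥n⇒m⊓n≡n (n≤1+n a)) cfA)
                             (reindex N vB (m≤n⇒m⊓n≡m (n≤1+n a)) cfB)
... | tri> _ _ b<a =
  N C suc (suc a) + vB , isMinFlat-∷ʳ-above k≤N minA minB (proj₁ step) ,
  reindex (suc N) (N C suc (suc a) + vB) b≡a⊓b (proj₂ step)
  where
  N : ℕ
  N = suc (suc (a + b))
  k≤N : suc (suc a) ≤ N
  k≤N = s≤s (s≤s (m≤m+n a b))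
  b≡a⊓b : suc b ≡ suc (a ⊓ b)
  b≡a⊓b = cong suc (sym (m≥n⇒m⊓n≡n (<⇒≤ b<a)))
  step : N C suc (suc a) + vB ≤ vA + N C a × ClosedForm (suc N) (suc b) (N C suc (suc a) + vB)
  step = closedForm-upperHalf a b b<a (reindex N vA (m≥n⇒m⊓n≡n (m≤n⇒m≤1+n (<⇒≤ b<a))) cfA)
                                      (reindex N vB (m≥n⇒m⊓n≡n b<a) cfB)

flatMinimum : ∀ a b → FlatMinimum (suc (a + b)) (suc a) (a ⊓ b)
flatMinimum zero    b       = 1 , isMinFlat-k≡1 b , refl
flatMinimum (suc a) zero    =
  1 , subst (λ n → IsMinFlat (suc n) (suc (suc a)) 1) (sym (+-identityʳ (suc a))) (isMinFlat-k≡n (suc a)) , refl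
flatMinimum (suc a) (suc b) =
  subst (λ n → FlatMinimum (suc n) (suc (suc a)) (suc (a ⊓ b))) (cong suc (sym (+-suc a b)))
        (flatMinimum-step a b (flatMinimum (suc a) b)
                              (subst (λ n → FlatMinimum (suc n) (suc a) (a ⊓ suc b)) (+-suc a b) (flatMinimum a (suc b))))

ClosedForm⇒≡ : ∀ {n j v} → ClosedForm n j v → v ≡ n C j ∸ catalanSum j
ClosedForm⇒≡ {n} {j} {v} cf = trans (sym (m+n∸n≡m v (catalanSum j))) (cong (_∸ catalanSum j) cf)

flatMinimum-symmetric : ∀ a b → a ≤ b → let n = suc (a + b) ; v = n C a ∸ catalanSum a in
  (IsMinFlatSize n (suc a) v × IsMinFlatSize n (b + 1) v) × catalanSum a ≤ n C a
flatMinimum-symmetric a b a≤b with flatMinimum a b | flatMinimum b a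
... | v , minA , cfA | v′ , minB , cfB =
  (subst (IsMinFlatSize n (suc a)) (ClosedForm⇒≡ {n} {a} {v} cfA′) (IsMinFlat⇒IsMinFlatSize {n} {a} {v} minA) ,
   subst₂ (IsMinFlatSize n) (+-comm 1 b) (ClosedForm⇒≡ {n} {a} {v′} cfB′)
          (IsMinFlat⇒IsMinFlatSize {n} {b} {v′} minB′)) ,
  subst (catalanSum a ≤_) cfA′ (m≤n+m (catalanSum a) v)
  where
  n : ℕ
  n = suc (a + b)
  cfA′ : ClosedForm n a v
  cfA′ = reindex n v (m≤n⇒m⊓n≡m a≤b) cfA
  minB′ : IsMinFlat n (suc b) v′
  minB′ = subst (λ m → IsMinFlat (suc m) (suc b) v′) (+-comm b a) minB
  cfB′ : ClosedForm n a v′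
  cfB′ = subst (λ m → ClosedForm (suc m) a v′) (+-comm b a) (reindex (suc (b + a)) v′ (m≥n⇒m⊓n≡n a≤b) cfB)

corollary10 : (n k : ℕ) → 1 ≤ k → 2 * k ≤ n + 1 →
    (IsMinFlatSize n k (n C (k ∸ 1) ∸ catalanSum (k ∸ 1))
     × IsMinFlatSize n (n ∸ k + 1) (n C (k ∸ 1) ∸ catalanSum (k ∸ 1)))
    × catalanSum (k ∸ 1) ≤ n C (k ∸ 1)
corollary10 n zero    () _
corollary10 n (suc a) _  2k≤n+1 = subst Conclusion n≡ (flatMinimum-symmetric a b a≤b)
  where
  b : ℕ
  b = n ∸ suc a
  Conclusion : ℕ → Set
  Conclusion m = (IsMinFlatSize m (suc a) (m C a ∸ catalanSum a) × IsMinFlatSize m (b + 1) (m C a ∸ catalanSum a))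
                 × catalanSum a ≤ m C a
  2a+1≤n : suc (a + a) ≤ n
  2a+1≤n = s≤s⁻¹ (subst₂ _≤_ (double a) (+-comm n 1) 2k≤n+1)
    where
    double : ∀ a → 2 * suc a ≡ suc (suc (a + a))
    double = solve-∀
  n≡ : suc (a + b) ≡ n
  n≡ = m+[n∸m]≡n (≤-trans (s≤s (m≤m+n a a)) 2a+1≤n)
  a≤b : a ≤ b
  a≤b = +-cancelˡ-≤ a a b (s≤s⁻¹ (subst (suc (a + a) ≤_) (sym n≡) 2a+1≤n))
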